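{- Let $k\geq 1$ and let $G$ be a shifted graph on vertex set $[n]$ with $\nu(G)=k$. Then $G$ is a subgraph of $H(n,k,\ell)$ for some integer $\ell$ with $k+1\leq \ell\leq 2k+1$ (and $\ell\leq n$).
   Context: Edges of a simple graph $G$ on $[n]=\{1,\dots,n\}$ are viewed as $2$-element subsets of $[n]$. For $1\leq i<j\leq n$ and $e\in E(G)$, the shifting $S_{ij}(e)$ is $(e\setminus\{j\})\cup\{i\}$ if $j\in e$, $i\notin e$ and $(e\setminus\{j\})\cup\{i\}\notin E(G)$; otherwise $S_{ij}(e)=e$. The graph $S_{ij}(G)$ has vertex set $[n]$ and edge set $\{S_{ij}(e): e\in E(G)\}$. $G$ is called shifted if $S_{ij}(G)=G$ for all $1\leq i<j\leq n$. $\nu(G)$ is the number of edges in a maximum matching of $G$. For $k+1\leq \ell\leq 2k+1$ with $\ell\leq n$, $H(n,k,\ell)$ is the graph on vertex set $[n]$ defined as follows: let $A=[\ell]$, $B=[n]\setminus A$, $C=[2k+1-\ell]\subseteq A$; the edges of $H(n,k,\ell)$ are all pairs inside $A$ together with all pairs $\{b,c\}$ with $b\in B$, $c\in C$. -}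

module Defs where

open import Data.Nat using (ℕ; suc; _+_; _*_; _∸_; _≤_; _<_)
open import Data.Fin using (Fin; toℕ; _≟_)
open import Data.Bool using (Bool; true; false; if_then_else_)
open import Data.Product using (_×_; _,_; Σ; ∃; ∃-syntax)
open import Data.Sum using (_⊎_)
open import Data.List using (List; length; concatMap; _∷_; [])
open import Data.List.Relation.Unary.All using (All)
open import Data.List.Relation.Unary.Unique.Propositional using (Unique)
open import Relation.Binary.PropositionalEquality using (_≡_; _≢_)
open import Relation.Nullary using (yes; no; ¬_)
open import Function.Bundles using (_⇔_)

-- A simple graph on vertex set [n], with vertices modelled as Fin n
-- (vertex v : Fin n plays the role of toℕ v + 1 ∈ [n]; order is preserved).
record Graph (n : ℕ) : Set where
  field
    adj   : Fin n → Fin n → Bool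
    sym   : ∀ a b → adj a b ≡ adj b a
    irrefl : ∀ a → adj a a ≡ false
open Graph public

-- An edge {a,b} is represented by an ordered pair; two pairs denote the
-- same 2-element set iff they agree up to swapping.
Pair : ℕ → Set
Pair n = Fin n × Fin n

SameEdge : ∀ {n} → Pair n → Pair n → Set
SameEdge (a , b) (x , y) = (a ≡ x × b ≡ y) ⊎ (a ≡ y × b ≡ x)

-- The shifting S_ij applied to the edge {a,b} of G:
-- if j ∈ e and i ∉ e and (e \ {j}) ∪ {i} ∉ E(G) then replace j by i, else e.
shiftEdge : ∀ {n} → Graph n → Fin n → Fin n → Pair n → Pair n
shiftEdge G i j (a , b) with j ≟ a | j ≟ b
... | yes _ | _ with i ≟ b
...   | yes _ = (a , b)
...   | no _  = if adj G i b then (a , b) else (i , b)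
shiftEdge G i j (a , b) | no _ | yes _ with i ≟ a
...   | yes _ = (a , b)
...   | no _  = if adj G a i then (a , b) else (a , i)
shiftEdge G i j (a , b) | no _ | no _ = (a , b)

ShiftedEdge : ∀ {n} → Graph n → Fin n → Fin n → Fin n → Fin n → Set
ShiftedEdge G i j x y =
  ∃[ a ] ∃[ b ] (adj G a b ≡ true × SameEdge (shiftEdge G i j (a , b)) (x , y))

IsShifted : ∀ {n} → Graph n → Set
IsShifted {n} G = ∀ (i j : Fin n) → toℕ i < toℕ j →
  ∀ (x y : Fin n) → (ShiftedEdge G i j x y ⇔ (adj G x y ≡ true))

-- A matching: a list of edges of G whose endpoints are pairwise distinct
-- (so the edges are distinct and pairwise disjoint). Its size is its length.
endpoints : ∀ {n} → List (Pair n) → List (Fin n)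
endpoints [] = []
endpoints ((a , b) ∷ M) = a ∷ b ∷ endpoints M

IsMatching : ∀ {n} → Graph n → List (Pair n) → Set
IsMatching G M = All (λ e → adj G (Data.Product.proj₁ e) (Data.Product.proj₂ e) ≡ true) M
               × Unique (endpoints M)

MatchingNumberIs : ∀ {n} → Graph n → ℕ → Set
MatchingNumberIs G k =
  (∃[ M ] (IsMatching G M × length M ≡ k))
  × (∀ M → IsMatching G M → length M ≤ k)

-- Edges of H(n,k,ℓ): A = [ℓ], B = [n] \ A, C = [2k+1-ℓ];
-- all pairs inside A, plus all pairs {b,c} with b ∈ B, c ∈ C.
-- (Vertex v : Fin n is in [m] iff toℕ v < m.)
HEdge : (n k ℓ : ℕ) → Fin n → Fin n → Set
HEdge n k ℓ x y = x ≢ y ×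
  ( (toℕ x < ℓ × toℕ y < ℓ)
  ⊎ (¬ (toℕ x < ℓ) × toℕ y < (2 * k + 1) ∸ ℓ)
  ⊎ (¬ (toℕ y < ℓ) × toℕ x < (2 * k + 1) ∸ ℓ) )

SubgraphOfH : ∀ {n} → Graph n → ℕ → ℕ → Set
SubgraphOfH {n} G k ℓ = ∀ x y → adj G x y ≡ true → HEdge n k ℓ x y

-- In a shifted graph an edge can be lowered: if {x, y} is an edge, u ≤ x, v ≤ y and
-- u < v, then {u, v} is an edge.  If n ≤ 2k + 1 take ℓ = n.  Otherwise the k + 1
-- disjoint pairs {k − d, k + 1 + d}, d ≤ k (vertices counted from 0), cannot all be
-- edges since ν(G) = k; if {k − d, k + 1 + d} is missing, put ℓ = k + 1 + d, so that
-- 2k + 1 − ℓ = k − d.  By lowering, an edge with an endpoint ≥ ℓ has its other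
-- endpoint < k − d, which says exactly that G ⊆ H(n, k, ℓ).
module Submission where

open import Defs
open import Data.Nat using (ℕ; suc; _+_; _*_; _≤_)
open import Data.Product using (_×_; ∃-syntax)

open import Data.Nat using (zero; _<_; _∸_; z≤n; s≤s; _≤?_; _<?_; NonZero; >-nonZero)
open import Data.Nat.Properties
open import Data.Nat.DivMod using (_mod_; m<n⇒m%n≡m)
open import Data.Nat.Tactic.RingSolver using (solve-∀)
open import Data.Fin using (Fin; toℕ)
open import Data.Fin.Properties using (toℕ-injective; toℕ-fromℕ<; toℕ<n; pigeonhole)
open import Data.Bool using (true; false)
open import Data.Bool.Properties using (¬-not; not-¬) renaming (_≟_ to _≟ᵇ_)
open import Data.Product using (_,_; proj₁; proj₂)
open import Data.Sum using (_⊎_; inj₁; inj₂)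
open import Data.List using (List; []; _∷_; length; lookup)
open import Data.List.Membership.Propositional.Properties using (∈-lookup)
open import Data.List.Relation.Unary.All as All using (All; []; _∷_)
open import Data.List.Relation.Unary.AllPairs using ([]; _∷_)
open import Data.List.Relation.Unary.Unique.Propositional using (Unique)
open import Function using (_∘_)
open import Function.Bundles using (Equivalence)
open import Relation.Nullary using (¬_; yes; no; contradiction)
open import Relation.Binary.PropositionalEquality as ≡
  using (_≡_; _≢_; refl; trans; cong; cong₂; subst; subst₂)

adj⇒≢ : ∀ {n} (G : Graph n) {x y} → adj G x y ≡ true → x ≢ y
adj⇒≢ G {x} xy refl = contradiction (trans (≡.sym xy) (irrefl G x)) λ ()

toℕ-<⇒≢ : ∀ {n} {u v : Fin n} → toℕ u < toℕ v → u ≢ v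
toℕ-<⇒≢ u<v = <⇒≢ u<v ∘ cong toℕ

shiftEdge-lowers : ∀ {n} (G : Graph n) {i j b} → i ≢ b → adj G i b ≡ false →
  shiftEdge G i j (j , b) ≡ (i , b)
shiftEdge-lowers G {i} {j} {b} i≢b ib with j Data.Fin.≟ j | j Data.Fin.≟ b
... | no j≢j | _ = contradiction refl j≢j
... | yes _ | _ with i Data.Fin.≟ b
...   | yes i≡b = contradiction i≡b i≢b
...   | no _ rewrite ib = refl

shifted⇒adj-lowerˡ : ∀ {n} {G : Graph n} → IsShifted G → ∀ {a b i} →
  adj G a b ≡ true → toℕ i ≤ toℕ a → i ≢ b → adj G i b ≡ true
shifted⇒adj-lowerˡ {G = G} shifted {a} {b} {i} ab i≤a i≢b with adj G i b in ib
... | true = refl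
... | false with m≤n⇒m<n∨m≡n i≤a
...   | inj₂ i≡a = trans (≡.sym ib) (subst (λ v → adj G v b ≡ true) (toℕ-injective (≡.sym i≡a)) ab)
...   | inj₁ i<a = trans (≡.sym ib) (Equivalence.to (shifted i a i<a i b) (a , b , ab , shifted-edge))
  where
  shifted-edge : SameEdge (shiftEdge G i a (a , b)) (i , b)
  shifted-edge rewrite shiftEdge-lowers G {j = a} i≢b ib = inj₁ (refl , refl)

shifted⇒adj-lower : ∀ {n} {G : Graph n} → IsShifted G → ∀ {x y u v} →
  adj G x y ≡ true → toℕ u ≤ toℕ x → toℕ v ≤ toℕ y → toℕ u < toℕ v → adj G u v ≡ true
shifted⇒adj-lower {G = G} shifted {x} {y} {u} {v} xy u≤x v≤y u<v =
  trans (sym G u v) (shifted⇒adj-lowerˡ shifted (trans (sym G y u) uy) v≤y (toℕ-<⇒≢ u<v ∘ ≡.sym))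
  where
  uy : adj G u y ≡ true
  uy = shifted⇒adj-lowerˡ shifted xy u≤x (toℕ-<⇒≢ (<-≤-trans u<v v≤y))

shifted-nonEdge⇒lowNeighbour : ∀ {n} {G : Graph n} → IsShifted G → ∀ {u v} →
  toℕ u < toℕ v → adj G u v ≡ false →
  ∀ {a b} → adj G a b ≡ true → ¬ (toℕ b < toℕ v) → toℕ a < toℕ u
shifted-nonEdge⇒lowNeighbour shifted {u} u<v uv {a} ab b≮v with toℕ a <? toℕ u
... | yes a<u = a<u
... | no a≮u = contradiction (shifted⇒adj-lower shifted ab (≮⇒≥ a≮u) (≮⇒≥ b≮v) u<v) (not-¬ uv)

-- HEdge n k ℓ x y unfolds to  x ≢ y × HShape ℓ ((2 * k + 1) ∸ ℓ) x y.
HShape : ∀ {n} → ℕ → ℕ → Fin n → Fin n → Set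
HShape ℓ c x y = (toℕ x < ℓ × toℕ y < ℓ)
               ⊎ (¬ (toℕ x < ℓ) × toℕ y < c)
               ⊎ (¬ (toℕ y < ℓ) × toℕ x < c)

shifted-nonEdge⇒HShape : ∀ {n} {G : Graph n} → IsShifted G → ∀ {u v} →
  toℕ u < toℕ v → adj G u v ≡ false →
  ∀ {x y} → adj G x y ≡ true → HShape (toℕ v) (toℕ u) x y
shifted-nonEdge⇒HShape {G = G} shifted {v = v} u<v uv {x} {y} xy
  with toℕ x <? toℕ v | toℕ y <? toℕ v
... | yes x<v | yes y<v = inj₁ (x<v , y<v)
... | _       | no y≮v  = inj₂ (inj₂ (y≮v , shifted-nonEdge⇒lowNeighbour shifted u<v uv xy y≮v))
... | no x≮v  | _       = inj₂ (inj₁ (x≮v , shifted-nonEdge⇒lowNeighbour shifted u<v uv (trans (sym G y x) xy) x≮v))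

Unique⇒lookup≢ : ∀ {A : Set} {xs : List A} → Unique xs →
  ∀ {i j} → toℕ i < toℕ j → lookup xs i ≢ lookup xs j
Unique⇒lookup≢ {xs = _ ∷ _} (x∉xs ∷ _) {Fin.zero} {Fin.suc j} _ = All.lookup x∉xs (∈-lookup j)
Unique⇒lookup≢ {xs = _ ∷ _} (_ ∷ unique) {Fin.suc i} {Fin.suc j} (s≤s i<j) = Unique⇒lookup≢ unique i<j

Unique⇒length≤ : ∀ {n} {xs : List (Fin n)} → Unique xs → length xs ≤ n
Unique⇒length≤ {n} {xs} unique with length xs ≤? n
... | yes |xs|≤n = |xs|≤n
... | no |xs|≰n with i , j , i<j , same ← pigeonhole (≰⇒> |xs|≰n) (lookup xs) =
  contradiction same (Unique⇒lookup≢ unique i<j)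

length-endpoints : ∀ {n} (M : List (Pair n)) → length (endpoints M) ≡ length M + length M
length-endpoints [] = refl
length-endpoints (_ ∷ M) =
  cong suc (trans (cong suc (length-endpoints M)) (≡.sym (+-suc (length M) (length M))))

matching⇒size≤ : ∀ {n} {G : Graph n} {M} → IsMatching G M → length M + length M ≤ n
matching⇒size≤ {M = M} (_ , unique) = subst (_≤ _) (length-endpoints M) (Unique⇒length≤ unique)

2*m+1≡m+1+m : ∀ m → 2 * m + 1 ≡ m + 1 + m
2*m+1≡m+1+m = solve-∀

module Ladder {n} (G : Graph n) (k : ℕ) (2k+1<n : 2 * k + 1 < n) where

  instance
    n-nonZero : NonZero n
    n-nonZero = >-nonZero (≤-<-trans z≤n 2k+1<n)

  vertex : ℕ → Fin n
  vertex m = m mod n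

  toℕ-vertex : ∀ {m} → m ≤ 2 * k + 1 → toℕ (vertex m) ≡ m
  toℕ-vertex m≤2k+1 = trans (toℕ-fromℕ< _) (m<n⇒m%n≡m (≤-<-trans m≤2k+1 2k+1<n))

  lo hi : ℕ → ℕ
  lo d = k ∸ d
  hi d = k + 1 + d

  2k+1∸hi≡lo : ∀ d → 2 * k + 1 ∸ hi d ≡ lo d
  2k+1∸hi≡lo d rewrite 2*m+1≡m+1+m k = [m+n]∸[m+o]≡n∸o (k + 1) k d

  k<hi : ∀ d → k < hi d
  k<hi d = ≤-trans (≤-reflexive (+-comm 1 k)) (m≤m+n (k + 1) d)

  lo<hi : ∀ d → lo d < hi d
  lo<hi d = ≤-<-trans (m∸n≤m k d) (k<hi d)

  hi≤2k+1 : ∀ {d} → d ≤ k → hi d ≤ 2 * k + 1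
  hi≤2k+1 {d} d≤k = subst (hi d ≤_) (≡.sym (2*m+1≡m+1+m k)) (+-monoʳ-≤ (k + 1) d≤k)

  toℕ-lo : ∀ d → toℕ (vertex (lo d)) ≡ lo d
  toℕ-lo d = toℕ-vertex (≤-trans (m∸n≤m k d) (<⇒≤ (<-≤-trans (k<hi 0) (hi≤2k+1 z≤n))))

  toℕ-hi : ∀ {d} → d ≤ k → toℕ (vertex (hi d)) ≡ hi d
  toℕ-hi d≤k = toℕ-vertex (hi≤2k+1 d≤k)

  Rung : ℕ → Set
  Rung d = adj G (vertex (lo d)) (vertex (hi d)) ≡ true

  ladder : ℕ → List (Pair n)
  ladder zero = []
  ladder (suc d) = (vertex (lo d) , vertex (hi d)) ∷ ladder d

  length-ladder : ∀ m → length (ladder m) ≡ m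
  length-ladder zero = refl
  length-ladder (suc m) = cong suc (length-ladder m)

  ladder-edges : ∀ {m} → (∀ {d} → d < m → Rung d) →
    All (λ e → adj G (proj₁ e) (proj₂ e) ≡ true) (ladder m)
  ladder-edges {zero} _ = []
  ladder-edges {suc m} rungs = rungs ≤-refl ∷ ladder-edges (rungs ∘ m≤n⇒m≤1+n)

  -- The endpoints of ladder m are exactly k + 1 − m, …, k + m; the next rung lies just outside.
  InWindow : ℕ → ℕ → Set
  InWindow m i = k < i + m × i < hi m

  window-widen : ∀ {m i} → InWindow m i → InWindow (suc m) i
  window-widen {m} {i} (k<i+m , i<hi) =
    <-≤-trans k<i+m (+-monoʳ-≤ i (n≤1+n m)) , <-≤-trans i<hi (+-monoʳ-≤ (k + 1) (n≤1+n m))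

  lo∈window : ∀ {d} → d ≤ k → InWindow (suc d) (lo d)
  lo∈window {d} d≤k =
    ≤-reflexive (≡.sym (trans (+-suc (lo d) d) (cong suc (m∸n+n≡m d≤k)))) ,
    <-≤-trans (lo<hi d) (+-monoʳ-≤ (k + 1) (n≤1+n d))

  hi∈window : ∀ d → InWindow (suc d) (hi d)
  hi∈window d = <-≤-trans (k<hi d) (m≤m+n (hi d) (suc d)) , +-monoʳ-< (k + 1) (n<1+n d)

  lo∉window : ∀ {d} → d ≤ k → ¬ InWindow d (lo d)
  lo∉window d≤k (k<k , _) = n≮n k (subst (k <_) (m∸n+n≡m d≤k) k<k)

  hi∉window : ∀ d → ¬ InWindow d (hi d)
  hi∉window d (_ , hi<hi) = n≮n (hi d) hi<hi

  outside⇒≢ : ∀ {m} {v w : Fin n} → ¬ InWindow m (toℕ v) → InWindow m (toℕ w) → v ≢ w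
  outside⇒≢ v∉ w∈ refl = v∉ w∈

  ladder-endpoints : ∀ m → m ≤ suc k →
    All (InWindow m ∘ toℕ) (endpoints (ladder m)) × Unique (endpoints (ladder m))
  ladder-endpoints zero _ = [] , []
  ladder-endpoints (suc d) (s≤s d≤k) =
    (lo-in ∷ hi-in ∷ All.map window-widen inside) ,
    ((lo≢hi ∷ All.map (outside⇒≢ lo-out) inside) ∷ All.map (outside⇒≢ hi-out) inside ∷ unique)
    where
    inside = proj₁ (ladder-endpoints d (m≤n⇒m≤1+n d≤k))
    unique = proj₂ (ladder-endpoints d (m≤n⇒m≤1+n d≤k))
    lo-in : InWindow (suc d) (toℕ (vertex (lo d)))
    lo-in = subst (InWindow (suc d)) (≡.sym (toℕ-lo d)) (lo∈window d≤k)
    hi-in : InWindow (suc d) (toℕ (vertex (hi d)))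
    hi-in = subst (InWindow (suc d)) (≡.sym (toℕ-hi d≤k)) (hi∈window d)
    lo-out : ¬ InWindow d (toℕ (vertex (lo d)))
    lo-out = subst (¬_ ∘ InWindow d) (≡.sym (toℕ-lo d)) (lo∉window d≤k)
    hi-out : ¬ InWindow d (toℕ (vertex (hi d)))
    hi-out = subst (¬_ ∘ InWindow d) (≡.sym (toℕ-hi d≤k)) (hi∉window d)
    lo≢hi : vertex (lo d) ≢ vertex (hi d)
    lo≢hi = toℕ-<⇒≢ (subst₂ _<_ (≡.sym (toℕ-lo d)) (≡.sym (toℕ-hi d≤k)) (lo<hi d))

  some-rung-missing : (∀ M → IsMatching G M → length M ≤ k) →
    ∃[ d ] (d < suc k × adj G (vertex (lo d)) (vertex (hi d)) ≡ false)
  some-rung-missing maximal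
    with anyUpTo? (λ d → adj G (vertex (lo d)) (vertex (hi d)) ≟ᵇ false) (suc k)
  ... | yes missing = missing
  ... | no none = contradiction (subst (_≤ k) (length-ladder (suc k)) (maximal _ full-ladder)) 1+n≰n
    where
    full-ladder : IsMatching G (ladder (suc k))
    full-ladder = ladder-edges (λ {d} d<k+1 → ¬-not (λ missing → none (d , d<k+1 , missing))) ,
                  proj₂ (ladder-endpoints (suc k) ≤-refl)

  missing-rung⇒SubgraphOfH : IsShifted G → ∀ {d} → d ≤ k →
    adj G (vertex (lo d)) (vertex (hi d)) ≡ false → SubgraphOfH G k (hi d)
  missing-rung⇒SubgraphOfH shifted {d} d≤k missing x y xy =
    adj⇒≢ G xy ,
    subst₂ (λ ℓ c → HShape ℓ c x y) (toℕ-hi d≤k) (trans (toℕ-lo d) (≡.sym (2k+1∸hi≡lo d)))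
      (shifted-nonEdge⇒HShape shifted lo<hi′ missing xy)
    where
    lo<hi′ : toℕ (vertex (lo d)) < toℕ (vertex (hi d))
    lo<hi′ = subst₂ _<_ (≡.sym (toℕ-lo d)) (≡.sym (toℕ-hi d≤k)) (lo<hi d)

  shifted⇒SubgraphOfH : IsShifted G → (∀ M → IsMatching G M → length M ≤ k) →
    ∃[ ℓ ] (k + 1 ≤ ℓ × ℓ ≤ 2 * k + 1 × ℓ ≤ n × SubgraphOfH G k ℓ)
  shifted⇒SubgraphOfH shifted maximal with some-rung-missing maximal
  ... | d , s≤s d≤k , missing =
    hi d , m≤m+n (k + 1) d , hi≤2k+1 d≤k , <⇒≤ (≤-<-trans (hi≤2k+1 d≤k) 2k+1<n) ,
    missing-rung⇒SubgraphOfH shifted d≤k missing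

SubgraphOfH-complete : ∀ {n} (G : Graph n) k → SubgraphOfH G k n
SubgraphOfH-complete G k x y xy = adj⇒≢ G xy , inj₁ (toℕ<n x , toℕ<n y)

lemma3p2 : (n k : ℕ) → 1 ≤ k → (G : Graph n) → IsShifted G → MatchingNumberIs G k →
    ∃[ ℓ ] (k + 1 ≤ ℓ × ℓ ≤ 2 * k + 1 × ℓ ≤ n × SubgraphOfH G k ℓ)
lemma3p2 n k 1≤k G shifted ((M , isMatching , |M|≡k) , maximal) with n ≤? 2 * k + 1
... | yes n≤2k+1 = n , k+1≤n , n≤2k+1 , ≤-refl , SubgraphOfH-complete G k
  where
  open ≤-Reasoning
  k+1≤n : k + 1 ≤ n
  k+1≤n = begin
    k + 1               ≤⟨ +-monoʳ-≤ k 1≤k ⟩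
    k + k               ≡⟨ cong₂ _+_ (≡.sym |M|≡k) (≡.sym |M|≡k) ⟩
    length M + length M ≤⟨ matching⇒size≤ {G = G} isMatching ⟩
    n                   ∎
... | no n≰2k+1 = Ladder.shifted⇒SubgraphOfH G k (≰⇒> n≰2k+1) shifted maximal
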